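{- Let $\bar a$ be an $l$-tuple in a Heyting algebra $A$. For every ball $B$ in $\mathrm{Es}(\bar p)$, there exists $y\in B$ with $\mathrm{fKer}\,\pi_{\bar a}\subseteq y$ if and only if $\varphi_B(\bar a)\to\psi_B(\bar a)\neq\mathbf 1$.
   Context: $\bar p=(p_1,\dots,p_l)$; $F(\bar p)$ is the free Heyting algebra on $\bar p$, with IPC formulas identified with its elements; degree = maximal nesting of $\to$. $\pi_{\bar a}:F(\bar p)\to A$ sends $\bar p$ to $\bar a$; $\mathrm{fKer}\,\pi_{\bar a}=\pi_{\bar a}^{ -1}(\mathbf 1)$. $\mathrm{Es}(\bar p)$ is the set of prime filters of $F(\bar p)$; $x\sim_d y$ means $x,y$ contain the same formulas of degree $\le d$; the balls of radius $2^{ -d}$ are the $\sim_d$-classes. For each ball $B$ (of radius $2^{ -d}$) a pair $(\varphi_B,\psi_B)$ of IPC formulas in $\bar p$ of degree $<d$ is fixed with $B=\{x:\varphi_B\in x\}\setminus\{x:\psi_B\in x\}$. -}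

module Defs where

open import Level using (Level)
open import Data.Nat using (ℕ; zero; suc; _⊔_; _≤_; _<_)
open import Data.Fin using (Fin)
open import Data.List using (List; []; _∷_)
open import Data.List.Membership.Propositional using (_∈_)
open import Data.Product using (_×_; Σ; _,_)
open import Data.Sum using (_⊎_)
open import Relation.Nullary using (¬_)
open import Relation.Binary.Lattice.Bundles using (HeytingAlgebra)

infixr 6 _∧′_
infixr 5 _∨′_
infixr 4 _⇒_

data Formula (l : ℕ) : Set where
  var  : Fin l → Formula l
  ⊥′   : Formula l
  ⊤′   : Formula l
  _∧′_ : Formula l → Formula l → Formula l
  _∨′_ : Formula l → Formula l → Formula l
  _⇒_  : Formula l → Formula l → Formula l

degree : ∀ {l} → Formula l → ℕ
degree (var _)   = 0
degree ⊥′        = 0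
degree ⊤′        = 0
degree (φ ∧′ ψ)  = degree φ ⊔ degree ψ
degree (φ ∨′ ψ)  = degree φ ⊔ degree ψ
degree (φ ⇒ ψ)   = suc (degree φ ⊔ degree ψ)

infix 2 _⊢_

data _⊢_ {l : ℕ} (Γ : List (Formula l)) : Formula l → Set where
  hyp  : ∀ {φ} → φ ∈ Γ → Γ ⊢ φ
  ⊤I   : Γ ⊢ ⊤′
  ⊥E   : ∀ {φ} → Γ ⊢ ⊥′ → Γ ⊢ φ
  ∧I   : ∀ {φ ψ} → Γ ⊢ φ → Γ ⊢ ψ → Γ ⊢ φ ∧′ ψ
  ∧E₁  : ∀ {φ ψ} → Γ ⊢ φ ∧′ ψ → Γ ⊢ φ
  ∧E₂  : ∀ {φ ψ} → Γ ⊢ φ ∧′ ψ → Γ ⊢ ψ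
  ∨I₁  : ∀ {φ ψ} → Γ ⊢ φ → Γ ⊢ φ ∨′ ψ
  ∨I₂  : ∀ {φ ψ} → Γ ⊢ ψ → Γ ⊢ φ ∨′ ψ
  ∨E   : ∀ {φ ψ χ} → Γ ⊢ φ ∨′ ψ → (φ ∷ Γ) ⊢ χ → (ψ ∷ Γ) ⊢ χ → Γ ⊢ χ
  ⇒I   : ∀ {φ ψ} → (φ ∷ Γ) ⊢ ψ → Γ ⊢ φ ⇒ ψ
  ⇒E   : ∀ {φ ψ} → Γ ⊢ φ ⇒ ψ → Γ ⊢ φ → Γ ⊢ ψ

-- The order of the free Heyting algebra F(p̄) (Lindenbaum–Tarski algebra
-- of IPC): φ ≤ ψ iff φ ⊢ ψ.  Elements of F(p̄) are represented by formulas.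
_≤F_ : ∀ {l} → Formula l → Formula l → Set
φ ≤F ψ = (φ ∷ []) ⊢ ψ

Subset : ℕ → Set₁
Subset l = Formula l → Set

record IsPrimeFilter {l : ℕ} (x : Subset l) : Set where
  field
    upward  : ∀ {φ ψ} → φ ≤F ψ → x φ → x ψ
    has-⊤   : x ⊤′
    meet    : ∀ {φ ψ} → x φ → x ψ → x (φ ∧′ ψ)
    proper  : ¬ x ⊥′
    prime   : ∀ {φ ψ} → x (φ ∨′ ψ) → x φ ⊎ x ψ

Es : ℕ → Set₁
Es l = Σ (Subset l) IsPrimeFilter

_∋_ : ∀ {l} → Es l → Formula l → Set
(x , _) ∋ φ = x φ

_∼[_]_ : ∀ {l} → Es l → ℕ → Es l → Set
x ∼[ d ] y = ∀ φ → degree φ ≤ d → (x ∋ φ → y ∋ φ) × (y ∋ φ → x ∋ φ)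

-- The ball of radius 2^{-d} around x₀ is its ∼_d-class.
InBall : ∀ {l} → ℕ → Es l → Es l → Set
InBall d x₀ y = y ∼[ d ] x₀

DefiningPair : ∀ {l} → ℕ → Es l → Formula l → Formula l → Set₁
DefiningPair {l} d x₀ φ ψ =
  degree φ < d × degree ψ < d ×
  (∀ (x : Es l) → InBall d x₀ x → (x ∋ φ) × ¬ (x ∋ ψ)) ×
  (∀ (x : Es l) → (x ∋ φ) → ¬ (x ∋ ψ) → InBall d x₀ x)

module _ {c ℓ₁ ℓ₂} (A : HeytingAlgebra c ℓ₁ ℓ₂) where
  open HeytingAlgebra A

  π : ∀ {l} → (Fin l → Carrier) → Formula l → Carrier
  π a (var i)  = a i
  π a ⊥′       = ⊥
  π a ⊤′       = ⊤
  π a (φ ∧′ ψ) = π a φ ∧ π a ψ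
  π a (φ ∨′ ψ) = π a φ ∨ π a ψ
  π a (φ ⇒ ψ)  = π a φ ⇨ π a ψ

  fKer : ∀ {l} → (Fin l → Carrier) → Formula l → Set ℓ₁
  fKer a φ = π a φ ≈ ⊤

  fKer⊆ : ∀ {l} → (Fin l → Carrier) → Es l → Set ℓ₁
  fKer⊆ a y = ∀ φ → fKer a φ → y ∋ φ

-- If fKer π_ā together with φ derived ψ in IPC, soundness in A would give π φ ≤ π ψ, i.e.
-- π (φ ⇒ ψ) = 𝟏. So when π (φ ⇒ ψ) ≠ 𝟏, a Lindenbaum construction along an enumeration of
-- all formulas (deciding consistency by excluded middle) extends fKer ∪ {φ} to a prime
-- filter omitting ψ, and the defining pair places it in B. Conversely, a point of B that
-- contains fKer contains φ and φ ⇒ ψ, hence ψ, which B excludes.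
module Submission where

open import Defs
open import Level using (Level)
open import Axiom.ExcludedMiddle using (ExcludedMiddle)
open import Data.Nat using (ℕ; zero; suc; _⊔_; _≤′_; ≤′-reflexive; ≤′-step; s≤s) renaming (_≤_ to _≤ℕ_)
open import Data.Nat.Properties using (≤-refl; ≤⇒≤′; m≤m⊔n; m≤n⊔m; m⊔n≤o⇒m≤o; m⊔n≤o⇒n≤o)
open import Data.Fin using (Fin)
open import Data.Product using (Σ; _×_; _,_; proj₁)
open import Data.Sum as Sum using (_⊎_; inj₁; inj₂)
open import Data.Empty using (⊥-elim)
open import Data.List using (List; []; _∷_; _++_; map; allFin; cartesianProductWith; concatMap)
open import Data.List.Relation.Unary.All as All using (All; []; _∷_)
open import Data.List.Relation.Unary.All.Properties using (++⁺)
open import Data.List.Relation.Unary.Any as Any using (here; there)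
open import Data.List.Membership.Propositional using (_∈_)
open import Data.List.Membership.Propositional.Properties
  using (∈-++⁺ˡ; ∈-++⁺ʳ; ∈-map⁺; ∈-allFin; ∈-cartesianProductWith⁺; ∈-concatMap⁺)
import Data.List.Relation.Binary.Subset.Propositional as List
open import Data.List.Relation.Binary.Subset.Propositional.Properties
  using (∷⁺ʳ; xs⊆xs++ys; xs⊆ys++xs; xs⊆x∷xs)
open import Relation.Nullary using (¬_; yes; no)
open import Relation.Nullary.Decidable using (True; toWitness; fromWitness)
open import Relation.Binary.PropositionalEquality using (_≡_; refl)
open import Relation.Binary.Structures using (IsEquivalence)
open import Relation.Unary using (Pred; _⊆_; _∪_; ｛_｝; ⋃)
open import Function.Base using (_∘_)
open import Function.Bundles using (_⇔_; mk⇔)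
open import Relation.Binary.Lattice.Bundles using (HeytingAlgebra)
import Relation.Binary.Lattice.Properties.HeytingAlgebra as HeytingAlgebraProperties

weaken : ∀ {l} {Γ Δ : List (Formula l)} {θ} → Γ List.⊆ Δ → Γ ⊢ θ → Δ ⊢ θ
weaken s (hyp m)    = hyp (s m)
weaken s ⊤I         = ⊤I
weaken s (⊥E d)     = ⊥E (weaken s d)
weaken s (∧I d e)   = ∧I (weaken s d) (weaken s e)
weaken s (∧E₁ d)    = ∧E₁ (weaken s d)
weaken s (∧E₂ d)    = ∧E₂ (weaken s d)
weaken s (∨I₁ d)    = ∨I₁ (weaken s d)
weaken s (∨I₂ d)    = ∨I₂ (weaken s d)
weaken s (∨E d e f) = ∨E (weaken s d) (weaken (∷⁺ʳ _ s) e) (weaken (∷⁺ʳ _ s) f)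
weaken s (⇒I d)     = ⇒I (weaken (∷⁺ʳ _ s) d)
weaken s (⇒E d e)   = ⇒E (weaken s d) (weaken s e)

weaken-∷ : ∀ {l} {Γ : List (Formula l)} {γ θ} → Γ ⊢ θ → γ ∷ Γ ⊢ θ
weaken-∷ = weaken (xs⊆x∷xs _ _)

cut : ∀ {l} {Γ : List (Formula l)} {α β} → α ≤F β → Γ ⊢ α → Γ ⊢ β
cut α≤β d = ⇒E (weaken (λ ()) (⇒I α≤β)) d

infix 2 _⊢ₛ_

_⊢ₛ_ : ∀ {l ℓ} → Pred (Formula l) ℓ → Formula l → Set ℓ
_⊢ₛ_ {l} S θ = Σ (List (Formula l)) λ Δ → All S Δ × (Δ ⊢ θ)

module _ {l : ℕ} {ℓ : Level} {S : Pred (Formula l) ℓ} where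

  ⊢ₛ-hyp : ∀ {θ} → S θ → S ⊢ₛ θ
  ⊢ₛ-hyp θ∈S = _ , θ∈S ∷ [] , hyp (here refl)

  ⊢ₛ-mono : ∀ {ℓ′} {S′ : Pred (Formula l) ℓ′} {θ} → S ⊆ S′ → S ⊢ₛ θ → S′ ⊢ₛ θ
  ⊢ₛ-mono S⊆S′ (Δ , Δ⊆S , d) = Δ , All.map S⊆S′ Δ⊆S , d

  ⊢ₛ-cut : ∀ {α β} → α ≤F β → S ⊢ₛ α → S ⊢ₛ β
  ⊢ₛ-cut α≤β (Δ , Δ⊆S , d) = Δ , Δ⊆S , cut α≤β d

  ⊢ₛ-rule₂ : ∀ {α β γ} → (∀ {Δ} → Δ ⊢ α → Δ ⊢ β → Δ ⊢ γ) → S ⊢ₛ α → S ⊢ₛ β → S ⊢ₛ γ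
  ⊢ₛ-rule₂ rule (Δ , Δ⊆S , d) (Δ′ , Δ′⊆S , d′) =
    Δ ++ Δ′ , ++⁺ Δ⊆S Δ′⊆S , rule (weaken (xs⊆xs++ys Δ Δ′) d) (weaken (xs⊆ys++xs Δ′ Δ) d′)

  ⊢ₛ-deduction : ∀ {α θ} → S ∪ ｛ α ｝ ⊢ₛ θ → S ⊢ₛ α ⇒ θ
  ⊢ₛ-deduction (Δ , Δ⊆S∪α , d) = discharge Δ⊆S∪α d
    where
    discharge : ∀ {Δ α θ} → All (S ∪ ｛ α ｝) Δ → Δ ⊢ θ → S ⊢ₛ α ⇒ θ
    discharge []               d = [] , [] , ⇒I (weaken-∷ d)
    discharge (inj₁ γ∈S ∷ Δ⊆)  d = ⊢ₛ-rule₂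
      (λ f g → ⇒I (⇒E (⇒E (weaken-∷ f) (hyp (here refl))) (weaken-∷ g)))
      (discharge Δ⊆ (⇒I d)) (⊢ₛ-hyp γ∈S)
    discharge (inj₂ refl ∷ Δ⊆) d = ⊢ₛ-cut
      (⇒I (⇒E (⇒E (hyp (there (here refl))) (hyp (here refl))) (hyp (here refl))))
      (discharge Δ⊆ (⇒I d))

module _ {c ℓ₁ ℓ₂ : Level} (A : HeytingAlgebra c ℓ₁ ℓ₂) {l : ℕ} (a : Fin l → HeytingAlgebra.Carrier A) where
  open HeytingAlgebra A hiding (refl)
  open IsEquivalence isEquivalence using () renaming (sym to ≈-sym)
  open HeytingAlgebra A using () renaming (refl to ≤ᴬ-refl)
  open HeytingAlgebraProperties A using (⇨-eval; ∧-distribˡ-∨-≤)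

  private
    assume : ∀ {Γ x φ} → All (λ γ → x ≤ π A a γ) Γ → All (λ γ → x ∧ π A a φ ≤ π A a γ) (φ ∷ Γ)
    assume Γ≥x = x∧y≤y _ _ ∷ All.map (trans (x∧y≤x _ _)) Γ≥x

  ⊢-sound : ∀ {Γ θ} → Γ ⊢ θ → ∀ x → All (λ γ → x ≤ π A a γ) Γ → x ≤ π A a θ
  ⊢-sound (hyp m)    x Γ≥x = All.lookup Γ≥x m
  ⊢-sound ⊤I         x Γ≥x = maximum x
  ⊢-sound (⊥E d)     x Γ≥x = trans (⊢-sound d x Γ≥x) (minimum _)
  ⊢-sound (∧I d e)   x Γ≥x = ∧-greatest (⊢-sound d x Γ≥x) (⊢-sound e x Γ≥x)
  ⊢-sound (∧E₁ d)    x Γ≥x = trans (⊢-sound d x Γ≥x) (x∧y≤x _ _)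
  ⊢-sound (∧E₂ d)    x Γ≥x = trans (⊢-sound d x Γ≥x) (x∧y≤y _ _)
  ⊢-sound (∨I₁ d)    x Γ≥x = trans (⊢-sound d x Γ≥x) (x≤x∨y _ _)
  ⊢-sound (∨I₂ d)    x Γ≥x = trans (⊢-sound d x Γ≥x) (y≤x∨y _ _)
  ⊢-sound (∨E {φ} {ψ} d e f) x Γ≥x =
    trans (∧-greatest ≤ᴬ-refl (⊢-sound d x Γ≥x))
   (trans (∧-distribˡ-∨-≤ x (π A a φ) (π A a ψ))
          (∨-least (⊢-sound e _ (assume Γ≥x)) (⊢-sound f _ (assume Γ≥x))))
  ⊢-sound (⇒I d)     x Γ≥x = transpose-⇨ (⊢-sound d _ (assume Γ≥x))
  ⊢-sound (⇒E d e)   x Γ≥x = trans (∧-greatest (⊢-sound d x Γ≥x) (⊢-sound e x Γ≥x)) ⇨-eval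

  ≤⇒⇨≈⊤ : ∀ {x y} → x ≤ y → x ⇨ y ≈ ⊤
  ≤⇒⇨≈⊤ x≤y = antisym (maximum _) (transpose-⇨ (trans (x∧y≤y _ _) x≤y))

  fKer∪｛φ｝⊢ₛθ⇒≤ : ∀ {φ θ} → fKer A a ∪ ｛ φ ｝ ⊢ₛ θ → π A a φ ≤ π A a θ
  fKer∪｛φ｝⊢ₛθ⇒≤ {φ} (Δ , Δ⊆ , d) = ⊢-sound d (π A a φ) (All.map above-φ Δ⊆)
    where
    above-φ : ∀ {γ} → (fKer A a ∪ ｛ φ ｝) γ → π A a φ ≤ π A a γ
    above-φ (inj₁ πγ≈⊤) = trans (maximum _) (reflexive (≈-sym πγ≈⊤))
    above-φ (inj₂ refl) = ≤ᴬ-refl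

  fKer∪｛φ｝⊬ψ : ∀ {φ ψ} → ¬ (π A a φ ⇨ π A a ψ ≈ ⊤) → ¬ (fKer A a ∪ ｛ φ ｝ ⊢ₛ ψ)
  fKer∪｛φ｝⊬ψ φ⇨ψ≉⊤ = φ⇨ψ≉⊤ ∘ ≤⇒⇨≈⊤ ∘ fKer∪｛φ｝⊢ₛθ⇒≤

height : ∀ {l} → Formula l → ℕ
height (var _)  = 0
height ⊥′       = 0
height ⊤′       = 0
height (φ ∧′ ψ) = suc (height φ ⊔ height ψ)
height (φ ∨′ ψ) = suc (height φ ⊔ height ψ)
height (φ ⇒ ψ)  = suc (height φ ⊔ height ψ)

atoms : ∀ l → List (Formula l)
atoms l = ⊥′ ∷ ⊤′ ∷ map var (allFin l)

applications : ∀ {l} → List (Formula l) → (Formula l → Formula l → Formula l) → List (Formula l)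
applications Φ _∙_ = cartesianProductWith _∙_ Φ Φ

connectives : ∀ {l} → List (Formula l → Formula l → Formula l)
connectives = _∧′_ ∷ _∨′_ ∷ _⇒_ ∷ []

compounds : ∀ {l} → List (Formula l) → List (Formula l)
compounds Φ = concatMap (applications Φ) connectives

formulas : ∀ l → ℕ → List (Formula l)
formulas l zero    = atoms l
formulas l (suc n) = atoms l ++ compounds (formulas l n)

∈-atoms⇒∈-formulas : ∀ {l θ} n → θ ∈ atoms l → θ ∈ formulas l n
∈-atoms⇒∈-formulas zero    θ∈ = θ∈
∈-atoms⇒∈-formulas (suc n) θ∈ = ∈-++⁺ˡ θ∈

∈-formulas : ∀ {l n} (θ : Formula l) → height θ ≤ℕ n → θ ∈ formulas l n
∈-compounds-formulas : ∀ {l n} {_∙_ : Formula l → Formula l → Formula l} → _∙_ ∈ connectives →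
                       ∀ φ ψ → height φ ⊔ height ψ ≤ℕ n → (φ ∙ ψ) ∈ compounds (formulas l n)

∈-formulas {n = n} (var i) _ = ∈-atoms⇒∈-formulas n (there (there (∈-map⁺ var (∈-allFin i))))
∈-formulas {n = n} ⊥′      _ = ∈-atoms⇒∈-formulas n (here refl)
∈-formulas {n = n} ⊤′      _ = ∈-atoms⇒∈-formulas n (there (here refl))
∈-formulas {l} (φ ∧′ ψ) (s≤s h≤n) = ∈-++⁺ʳ (atoms l) (∈-compounds-formulas (here refl) φ ψ h≤n)
∈-formulas {l} (φ ∨′ ψ) (s≤s h≤n) = ∈-++⁺ʳ (atoms l) (∈-compounds-formulas (there (here refl)) φ ψ h≤n)
∈-formulas {l} (φ ⇒ ψ)  (s≤s h≤n) = ∈-++⁺ʳ (atoms l) (∈-compounds-formulas (there (there (here refl))) φ ψ h≤n)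

∈-compounds-formulas {l} {n} ∙∈ φ ψ h≤n = ∈-concatMap⁺ (applications (formulas l n)) (Any.map (λ where
  refl → ∈-cartesianProductWith⁺ _ (∈-formulas φ (m⊔n≤o⇒m≤o _ _ h≤n)) (∈-formulas ψ (m⊔n≤o⇒n≤o _ _ h≤n))) ∙∈)

module _ {ℓ : Level} (em : ExcludedMiddle ℓ) {l : ℕ} where

  -- Points of Es l are subsets in Set, so a theory living in Set ℓ is brought down by deciding membership.
  decided : Pred (Formula l) ℓ → Subset l
  decided Y θ = True (em {Y θ})

  primeTheory⇒isPrimeFilter : ∀ {Y} → (∀ {θ} → Y ⊢ₛ θ → Y θ) → ¬ Y ⊥′ →
                               (∀ {α β} → Y (α ∨′ β) → Y α ⊎ Y β) → IsPrimeFilter (decided Y)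
  primeTheory⇒isPrimeFilter closed proper prime = record
    { upward = λ α≤β α∈Y → fromWitness (closed (⊢ₛ-cut α≤β (⊢ₛ-hyp (toWitness α∈Y))))
    ; has-⊤  = fromWitness (closed ([] , [] , ⊤I))
    ; meet   = λ α∈Y β∈Y → fromWitness (closed (⊢ₛ-rule₂ ∧I (⊢ₛ-hyp (toWitness α∈Y)) (⊢ₛ-hyp (toWitness β∈Y))))
    ; proper = λ ⊥∈Y → proper (toWitness ⊥∈Y)
    ; prime  = λ α∨β∈Y → Sum.map fromWitness fromWitness (prime (toWitness α∨β∈Y))
    }

module Lindenbaum {ℓ : Level} (em : ExcludedMiddle ℓ) {l : ℕ} (ψ : Formula l) where

  Consistent : Pred (Formula l) ℓ → Set ℓ
  Consistent S = ¬ (S ⊢ₛ ψ)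

  tryAdd : Formula l → Pred (Formula l) ℓ → Pred (Formula l) ℓ
  tryAdd χ S θ = S θ ⊎ (χ ≡ θ × Consistent (S ∪ ｛ χ ｝))

  tryAddAll : List (Formula l) → Pred (Formula l) ℓ → Pred (Formula l) ℓ
  tryAddAll []      S = S
  tryAddAll (χ ∷ L) S = tryAddAll L (tryAdd χ S)

  tryAddAll-inflationary : ∀ L {S} → S ⊆ tryAddAll L S
  tryAddAll-inflationary []      θ∈S = θ∈S
  tryAddAll-inflationary (χ ∷ L) θ∈S = tryAddAll-inflationary L (inj₁ θ∈S)

  tryAdd-consistent : ∀ {χ S} → Consistent S → Consistent (tryAdd χ S)
  tryAdd-consistent {χ} {S} S-cons with em {Consistent (S ∪ ｛ χ ｝)}
  ... | yes S∪χ-cons = S∪χ-cons ∘ ⊢ₛ-mono (Sum.map₂ proj₁)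
  ... | no ¬S∪χ-cons = S-cons ∘ ⊢ₛ-mono λ where
    (inj₁ θ∈S)            → θ∈S
    (inj₂ (_ , S∪χ-cons)) → ⊥-elim (¬S∪χ-cons S∪χ-cons)

  tryAddAll-consistent : ∀ L {S} → Consistent S → Consistent (tryAddAll L S)
  tryAddAll-consistent []      S-cons = S-cons
  tryAddAll-consistent (χ ∷ L) S-cons = tryAddAll-consistent L (tryAdd-consistent S-cons)

  tryAddAll-rejected : ∀ {L S α} → α ∈ L → ¬ tryAddAll L S α →
                       Σ (Pred (Formula l) ℓ) λ S′ → S′ ⊆ tryAddAll L S × (S′ ∪ ｛ α ｝ ⊢ₛ ψ)
  tryAddAll-rejected {α ∷ L} {S} (here refl) α∉ with em {S ∪ ｛ α ｝ ⊢ₛ ψ}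
  ... | yes S∪α⊢ψ = S , tryAddAll-inflationary (α ∷ L) , S∪α⊢ψ
  ... | no S∪α-cons = ⊥-elim (α∉ (tryAddAll-inflationary L (inj₂ (refl , S∪α-cons))))
  tryAddAll-rejected {χ ∷ L} (there α∈L) α∉ = tryAddAll-rejected {L} α∈L α∉

  module _ (Γ : Pred (Formula l) ℓ) where

    stage : ℕ → Pred (Formula l) ℓ
    stage zero    = Γ
    stage (suc n) = tryAddAll (formulas l n) (stage n)

    limit : Pred (Formula l) ℓ
    limit = ⋃ ℕ stage

    stage-mono : ∀ {m n} → m ≤ℕ n → stage m ⊆ stage n
    stage-mono = go ∘ ≤⇒≤′
      where
      go : ∀ {m n} → m ≤′ n → stage m ⊆ stage n
      go (≤′-reflexive refl) θ∈ = θ∈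
      go (≤′-step {n} m≤′n)  θ∈ = tryAddAll-inflationary (formulas l n) (go m≤′n θ∈)

    All-limit⇒All-stage : ∀ {Δ} → All limit Δ → Σ ℕ λ n → All (stage n) Δ
    All-limit⇒All-stage []              = 0 , []
    All-limit⇒All-stage ((m , θ∈) ∷ Δ⊆) with All-limit⇒All-stage Δ⊆
    ... | n , Δ⊆stage = m ⊔ n , stage-mono (m≤m⊔n m n) θ∈ ∷ All.map (stage-mono (m≤n⊔m m n)) Δ⊆stage

    limit-maximal : ∀ {α} → ¬ limit α → limit ∪ ｛ α ｝ ⊢ₛ ψ
    limit-maximal {α} α∉limit with tryAddAll-rejected (∈-formulas α ≤-refl) (α∉limit ∘ (suc (height α) ,_))
    ... | S′ , S′⊆ , S′∪α⊢ψ = ⊢ₛ-mono (Sum.map₁ ((suc (height α) ,_) ∘ S′⊆)) S′∪α⊢ψ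

    module _ (Γ-cons : Consistent Γ) where

      stage-consistent : ∀ n → Consistent (stage n)
      stage-consistent zero    = Γ-cons
      stage-consistent (suc n) = tryAddAll-consistent (formulas l n) (stage-consistent n)

      limit-consistent : Consistent limit
      limit-consistent (Δ , Δ⊆limit , d) with All-limit⇒All-stage Δ⊆limit
      ... | n , Δ⊆stage = stage-consistent n (Δ , Δ⊆stage , d)

      limit-closed : ∀ {θ} → limit ⊢ₛ θ → limit θ
      limit-closed {θ} limit⊢θ with em {limit θ}
      ... | yes θ∈limit = θ∈limit
      ... | no θ∉limit  = ⊥-elim (limit-consistent
        (⊢ₛ-rule₂ ⇒E (⊢ₛ-deduction (limit-maximal θ∉limit)) limit⊢θ))

      limit-prime : ∀ {α β} → limit (α ∨′ β) → limit α ⊎ limit β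
      limit-prime {α} {β} α∨β∈limit with em {limit α} | em {limit β}
      ... | yes α∈limit | _           = inj₁ α∈limit
      ... | no _        | yes β∈limit = inj₂ β∈limit
      ... | no α∉limit  | no β∉limit  = ⊥-elim (limit-consistent (⊢ₛ-rule₂ by-cases (⊢ₛ-hyp α∨β∈limit)
        (⊢ₛ-rule₂ ∧I (⊢ₛ-deduction (limit-maximal α∉limit)) (⊢ₛ-deduction (limit-maximal β∉limit)))))
        where
        by-cases : ∀ {Δ} → Δ ⊢ α ∨′ β → Δ ⊢ (α ⇒ ψ) ∧′ (β ⇒ ψ) → Δ ⊢ ψ
        by-cases d e = ∨E d (⇒E (∧E₁ (weaken-∷ e)) (hyp (here refl))) (⇒E (∧E₂ (weaken-∷ e)) (hyp (here refl)))

      lindenbaum : Σ (Es l) λ y → Γ ⊆ (y ∋_) × ¬ (y ∋ ψ)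
      lindenbaum = (decided em limit , primeTheory⇒isPrimeFilter em limit-closed limit-proper limit-prime)
                 , (λ θ∈Γ → fromWitness (0 , θ∈Γ))
                 , (λ ψ∈y → limit-consistent (⊢ₛ-hyp (toWitness ψ∈y)))
        where
        limit-proper : ¬ limit ⊥′
        limit-proper ⊥∈limit = limit-consistent (⊢ₛ-cut (⊥E (hyp (here refl))) (⊢ₛ-hyp ⊥∈limit))

∈-⇒E : ∀ {l} (x : Es l) {α β} → x ∋ (α ⇒ β) → x ∋ α → x ∋ β
∈-⇒E (_ , x-prime) α⇒β∈x α∈x = upward (⇒E (∧E₁ (hyp (here refl))) (∧E₂ (hyp (here refl)))) (meet α⇒β∈x α∈x)
  where open IsPrimeFilter x-prime

claim2p8 : (lem : ∀ ℓ → ExcludedMiddle ℓ)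
    → ∀ {c ℓ₁ ℓ₂} (A : HeytingAlgebra c ℓ₁ ℓ₂) (l : ℕ)
    → (a : Fin l → HeytingAlgebra.Carrier A)
    → (d : ℕ) (x₀ : Es l) (φ ψ : Formula l) → DefiningPair d x₀ φ ψ
    → (Σ (Es l) (λ y → InBall d x₀ y × fKer⊆ A a y))
      ⇔ (¬ (HeytingAlgebra._≈_ A (HeytingAlgebra._⇨_ A (π A a φ) (π A a ψ)) (HeytingAlgebra.⊤ A)))
claim2p8 lem {ℓ₁ = ℓ₁} A l a d x₀ φ ψ (_ , _ , ball⇒φ∖ψ , φ∖ψ⇒ball) = mk⇔ necessity sufficiency
  where
  open HeytingAlgebra A using (_≈_; _⇨_; ⊤)
  open Lindenbaum (lem ℓ₁) ψ using (lindenbaum)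

  necessity : Σ (Es l) (λ y → InBall d x₀ y × fKer⊆ A a y) → ¬ (π A a φ ⇨ π A a ψ ≈ ⊤)
  necessity (y , y∈B , fKer⊆y) φ⇨ψ≈⊤ with ball⇒φ∖ψ y y∈B
  ... | φ∈y , ψ∉y = ψ∉y (∈-⇒E y (fKer⊆y (φ ⇒ ψ) φ⇨ψ≈⊤) φ∈y)

  sufficiency : ¬ (π A a φ ⇨ π A a ψ ≈ ⊤) → Σ (Es l) (λ y → InBall d x₀ y × fKer⊆ A a y)
  sufficiency φ⇨ψ≉⊤ with lindenbaum (fKer A a ∪ ｛ φ ｝) (fKer∪｛φ｝⊬ψ A a φ⇨ψ≉⊤)
  ... | y , Γ⊆y , ψ∉y = y , φ∖ψ⇒ball y (Γ⊆y (inj₂ refl)) ψ∉y , λ θ πθ≈⊤ → Γ⊆y (inj₁ πθ≈⊤)
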